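{- For $n\ge1$ let $L(n)$ be the last part of an Arndt composition of $n$ chosen uniformly at random. Then $\mathbb{E}[L(n)]\to\sqrt 5$ as $n\to\infty$.
   Context: A composition of $n$ is a finite sequence $(\sigma_1,\dots,\sigma_\ell)$ of positive integers summing to $n$; its last part is $\sigma_\ell$. An Arndt composition is one with $\sigma_{2i-1}>\sigma_{2i}$ for every positive integer $i$ with $2i\le\ell$. -}

module Defs where

open import Data.Nat using (ℕ; zero; suc; _∸_; _<ᵇ_; _≤_)
open import Data.Bool using (Bool; true; false; _∧_; T)
open import Data.List using (List; []; _∷_; [_]; map; concatMap; upTo; filterᵇ; length)
open import Data.Nat.ListAction using (sum)
open import Data.Integer using (+_)
open import Data.Product using (Σ; _×_)
open import Data.Sum using (_⊎_)
open import Data.Rational.Unnormalised using (ℚᵘ; mkℚᵘ; _<_; _+_; _-_; _*_; 0ℚᵘ)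

-- All compositions of m (lists of positive integers summing to m), using fuel f ≥ m.
compositionsF : ℕ → ℕ → List (List ℕ)
compositionsF _       zero    = [ [] ]
compositionsF zero    (suc m) = []
compositionsF (suc f) (suc m) =
  concatMap (λ k → map (suc k ∷_) (compositionsF f (m ∸ k))) (upTo (suc m))

compositions : ℕ → List (List ℕ)
compositions n = compositionsF n n

isArndt : List ℕ → Bool
isArndt (a ∷ b ∷ rest) = (b <ᵇ a) ∧ isArndt rest
isArndt _              = true

arndtCompositions : ℕ → List (List ℕ)
arndtCompositions n = filterᵇ isArndt (compositions n)

lastPart : List ℕ → ℕ
lastPart []           = 0
lastPart (x ∷ [])     = x
lastPart (_ ∷ y ∷ ys) = lastPart (y ∷ ys)

arndtCount : ℕ → ℕ
arndtCount n = length (arndtCompositions n)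

lastPartTotal : ℕ → ℕ
lastPartTotal n = sum (map lastPart (arndtCompositions n))

-- E[L(n)] = lastPartTotal n / arndtCount n  (arndtCount n ≥ 1 for n ≥ 1,
-- since (n) is an Arndt composition; mkℚᵘ p d denotes p / (suc d))
expectedLast : ℕ → ℚᵘ
expectedLast n = mkℚᵘ (+ lastPartTotal n) (arndtCount n ∸ 1)

five : ℚᵘ
five = mkℚᵘ (+ 5) 0

BelowSqrt5 : ℚᵘ → Set
BelowSqrt5 q = q < 0ℚᵘ ⊎ q * q < five

AboveSqrt5 : ℚᵘ → Set
AboveSqrt5 q = 0ℚᵘ < q × five < q * q

ConvergesToSqrt5 : (ℕ → ℚᵘ) → Set
ConvergesToSqrt5 a =
  (ε : ℚᵘ) → 0ℚᵘ < ε → Σ ℕ λ N → (n : ℕ) → N ≤ n →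
    BelowSqrt5 (a n - ε) × AboveSqrt5 (a n + ε)

{-# OPTIONS --safe #-}
-- Adding 1 to the first part embeds the Arndt compositions of n − 1 into those of n,
-- missing exactly the ones that open with a pair (a + 1, a).  For a = 1 these correspond
-- to the Arndt compositions of n − 3, and lowering the pair to (a, a − 1) identifies the
-- rest with the compositions of n − 2 opening with such a pair.  These Fibonacci-type
-- recurrences give A = F(n) Arndt compositions of n; following last parts through the same
-- maps (only the one-part composition and, for odd n, the two-part one change their last
-- part) gives the total B = L(n) − [n even] of last parts, L being the Lucas numbers.
-- Since L(n)² − 5F(n)² = 4(−1)ⁿ, we get B² < 5A² ≤ (B + 2)², so the mean B/A lies within
-- 2/A below √5, and A = F(n) is unbounded.
module Submission where

open import Defs
open import Data.Bool using (true; false; if_then_else_)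
open import Data.Integer as ℤ using (ℤ; +_; +[1+_]; -[1+_]; -1ℤ; 1ℤ; _^_)
import Data.Integer.Properties as ℤ
import Data.Integer.Tactic.RingSolver as ℤ-Solver
open import Data.List using (List; []; _∷_; map; concatMap; upTo; applyUpTo; filterᵇ; length; _++_)
open import Data.List.Properties using (concatMap-cong; map-concatMap; map-upTo; map-++; filter-++; map-cong)
open import Data.Nat using (ℕ; zero; suc; _+_; _*_; _∸_; _≤_; _<_; _<ᵇ_; z≤n; s≤s; s≤s⁻¹)
open import Data.Nat.ListAction using (sum)
open import Data.Nat.ListAction.Properties using (sum-++)
open import Data.Nat.Properties
open import Algebra.Properties.CommutativeSemigroup +-commutativeSemigroup using (interchange)
open import Data.Nat.Tactic.RingSolver using (solve-∀)
open import Data.Product using (_×_; _,_; proj₁)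
open import Data.Rational.Unnormalised as ℚ using (mkℚᵘ; 0ℚᵘ; *<*; nonNegative)
import Data.Rational.Unnormalised.Properties as ℚ
open import Data.Sum using (inj₁; inj₂; _⊎_)
open import Function using (_∘_)
open import Relation.Nullary using (yes; no; contradiction)
open import Relation.Binary.PropositionalEquality

antidiagonalSum : ℕ → (ℕ → ℕ → ℕ) → ℕ
antidiagonalSum zero    h = h 0 0
antidiagonalSum (suc m) h = h (suc m) 0 + antidiagonalSum m (λ i j → h i (suc j))

sum-upTo-antidiagonal : ∀ m h → sum (map (λ k → h (m ∸ k) k) (upTo (suc m))) ≡ antidiagonalSum m h
sum-upTo-antidiagonal m h = trans (cong sum (map-upTo _ (suc m))) (applyUpTo-antidiagonal m h)
  where
  applyUpTo-antidiagonal : ∀ m h → sum (applyUpTo (λ k → h (m ∸ k) k) (suc m)) ≡ antidiagonalSum m h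
  applyUpTo-antidiagonal zero    h = +-identityʳ (h 0 0)
  applyUpTo-antidiagonal (suc m) h = cong (_+_ (h (suc m) 0)) (applyUpTo-antidiagonal m (λ i j → h i (suc j)))

antidiagonalSum-cong : ∀ m {g h : ℕ → ℕ → ℕ} → (∀ i j → g i j ≡ h i j) →
  antidiagonalSum m g ≡ antidiagonalSum m h
antidiagonalSum-cong zero    eq = eq 0 0
antidiagonalSum-cong (suc m) eq = cong₂ _+_ (eq (suc m) 0) (antidiagonalSum-cong m (λ i j → eq i (suc j)))

antidiagonalSum-zero : ∀ m → antidiagonalSum m (λ _ _ → 0) ≡ 0
antidiagonalSum-zero zero    = refl
antidiagonalSum-zero (suc m) = antidiagonalSum-zero m

antidiagonalSum-+ : ∀ m g h →
  antidiagonalSum m (λ i j → g i j + h i j) ≡ antidiagonalSum m g + antidiagonalSum m h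
antidiagonalSum-+ zero    g h = refl
antidiagonalSum-+ (suc m) g h = trans
  (cong (_+_ (g (suc m) 0 + h (suc m) 0)) (antidiagonalSum-+ m (λ i j → g i (suc j)) (λ i j → h i (suc j))))
  (interchange (g (suc m) 0) (h (suc m) 0) _ _)

antidiagonalSum-peel : ∀ m h →
  antidiagonalSum (suc m) h ≡ antidiagonalSum m (λ i j → h (suc i) j) + h 0 (suc m)
antidiagonalSum-peel zero    h = refl
antidiagonalSum-peel (suc m) h = trans
  (cong (_+_ (h (suc (suc m)) 0)) (antidiagonalSum-peel m (λ i j → h i (suc j))))
  (sym (+-assoc (h (suc (suc m)) 0) _ _))

antidiagonalEntry : ℕ → ℕ → (ℕ → ℕ → ℕ) → ℕ
antidiagonalEntry m       zero    g = g m 0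
antidiagonalEntry zero    (suc c) g = 0
antidiagonalEntry (suc m) (suc c) g = antidiagonalEntry m c (λ i j → g i (suc j))

antidiagonalEntry-cong : ∀ m c {g h : ℕ → ℕ → ℕ} → (∀ i j → g i j ≡ h i j) →
  antidiagonalEntry m c g ≡ antidiagonalEntry m c h
antidiagonalEntry-cong m       zero    eq = eq m 0
antidiagonalEntry-cong zero    (suc c) eq = refl
antidiagonalEntry-cong (suc m) (suc c) eq = antidiagonalEntry-cong m c (λ i j → eq i (suc j))

antidiagonalEntry-+ : ∀ m c g h →
  antidiagonalEntry m c (λ i j → g i j + h i j) ≡ antidiagonalEntry m c g + antidiagonalEntry m c h
antidiagonalEntry-+ m       zero    g h = refl
antidiagonalEntry-+ zero    (suc c) g h = refl
antidiagonalEntry-+ (suc m) (suc c) g h = antidiagonalEntry-+ m c (λ i j → g i (suc j)) (λ i j → h i (suc j))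

antidiagonalSumBelow : ℕ → ℕ → (ℕ → ℕ → ℕ) → ℕ
antidiagonalSumBelow m c g = antidiagonalSum m (λ i j → if j <ᵇ c then g i j else 0)

antidiagonalSumBelow-suc : ∀ m c g →
  antidiagonalSumBelow m (suc c) g ≡ antidiagonalSumBelow m c g + antidiagonalEntry m c g
antidiagonalSumBelow-suc zero    zero    g = refl
antidiagonalSumBelow-suc zero    (suc c) g = sym (+-identityʳ (g 0 0))
antidiagonalSumBelow-suc (suc m) zero    g = +-comm (g (suc m) 0) _
antidiagonalSumBelow-suc (suc m) (suc c) g = trans
  (cong (_+_ (g (suc m) 0)) (antidiagonalSumBelow-suc m c (λ i j → g i (suc j))))
  (sym (+-assoc (g (suc m) 0) _ _))

evenBit : ℕ → ℕ
oddBit  : ℕ → ℕ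
evenBit zero    = 1
evenBit (suc n) = oddBit n

oddBit zero    = 0
oddBit (suc n) = evenBit n

zeroBit : ℕ → ℕ
zeroBit zero    = 1
zeroBit (suc _) = 0

diagonalBit : ℕ → ℕ → ℕ
diagonalBit zero    zero    = 1
diagonalBit zero    (suc _) = 0
diagonalBit (suc _) zero    = 0
diagonalBit (suc m) (suc c) = diagonalBit m c

antidiagonalEntry-zeroBit : ∀ m c → antidiagonalEntry m c (λ i _ → zeroBit i) ≡ diagonalBit m c
antidiagonalEntry-zeroBit zero    zero    = refl
antidiagonalEntry-zeroBit (suc m) zero    = refl
antidiagonalEntry-zeroBit zero    (suc c) = refl
antidiagonalEntry-zeroBit (suc m) (suc c) = antidiagonalEntry-zeroBit m c

antidiagonalSum-diagonalBit : ∀ n → antidiagonalSum n diagonalBit ≡ evenBit n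
antidiagonalSum-diagonalBit zero          = refl
antidiagonalSum-diagonalBit (suc zero)    = refl
antidiagonalSum-diagonalBit (suc (suc n)) =
  trans (antidiagonalSum-peel n (λ i j → diagonalBit i (suc j)))
        (trans (+-identityʳ _) (antidiagonalSum-diagonalBit n))

compositionsF-fuel : ∀ {f g} m → m ≤ f → m ≤ g → compositionsF f m ≡ compositionsF g m
compositionsF-fuel zero _ _ = refl
compositionsF-fuel {suc f} {suc g} (suc m) 1+m≤1+f 1+m≤1+g = concatMap-cong
  (λ k → cong (map (suc k ∷_)) (compositionsF-fuel (m ∸ k)
     (≤-trans (m∸n≤m m k) (s≤s⁻¹ 1+m≤1+f)) (≤-trans (m∸n≤m m k) (s≤s⁻¹ 1+m≤1+g))))
  (upTo (suc m))

compositions-suc : ∀ m →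
  compositions (suc m) ≡ concatMap (λ k → map (suc k ∷_) (compositions (m ∸ k))) (upTo (suc m))
compositions-suc m = concatMap-cong
  (λ k → cong (map (suc k ∷_)) (compositionsF-fuel (m ∸ k) (m∸n≤m m k) ≤-refl))
  (upTo (suc m))

arndtSum : (List ℕ → ℕ) → List (List ℕ) → ℕ
arndtSum w L = sum (map w (filterᵇ isArndt L))

arndtSum-++ : ∀ w xs ys → arndtSum w (xs ++ ys) ≡ arndtSum w xs + arndtSum w ys
arndtSum-++ w xs ys = begin
  sum (map w (filterᵇ isArndt (xs ++ ys)))
    ≡⟨ cong (sum ∘ map w) (filter-++ _ xs ys) ⟩
  sum (map w (filterᵇ isArndt xs ++ filterᵇ isArndt ys))
    ≡⟨ cong sum (map-++ w (filterᵇ isArndt xs) (filterᵇ isArndt ys)) ⟩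
  sum (map w (filterᵇ isArndt xs) ++ map w (filterᵇ isArndt ys))
    ≡⟨ sum-++ (map w (filterᵇ isArndt xs)) (map w (filterᵇ isArndt ys)) ⟩
  arndtSum w xs + arndtSum w ys ∎
  where open ≡-Reasoning

arndtSum-concatMap : ∀ {A : Set} w (f : A → List (List ℕ)) xs →
  arndtSum w (concatMap f xs) ≡ sum (map (arndtSum w ∘ f) xs)
arndtSum-concatMap w f [] = refl
arndtSum-concatMap w f (x ∷ xs) = trans (arndtSum-++ w (f x) (concatMap f xs))
  (cong (_+_ (arndtSum w (f x))) (arndtSum-concatMap w f xs))

arndtSum-cons-cong : ∀ {w w′} a → (∀ c → w (a ∷ c) ≡ w′ (a ∷ c)) →
  ∀ L → arndtSum w (map (a ∷_) L) ≡ arndtSum w′ (map (a ∷_) L)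
arndtSum-cons-cong a eq [] = refl
arndtSum-cons-cong a eq (c ∷ L) with isArndt (a ∷ c)
... | true  = cong₂ _+_ (eq c) (arndtSum-cons-cong a eq L)
... | false = arndtSum-cons-cong a eq L

arndtSum-pair : ∀ w a b L → arndtSum w (map (a ∷_) (map (b ∷_) L)) ≡
  (if b <ᵇ a then arndtSum (λ c → w (a ∷ b ∷ c)) L else 0)
arndtSum-pair w a b [] with b <ᵇ a
... | true  = refl
... | false = refl
arndtSum-pair w a b (c ∷ L) with b <ᵇ a | isArndt c | arndtSum-pair w a b L
... | true  | true  | ih = cong (_+_ (w (a ∷ b ∷ c))) ih
... | true  | false | ih = ih
... | false | _     | ih = ih

headedSum : (List ℕ → ℕ) → ℕ → ℕ → ℕ
headedSum w m a = arndtSum w (map (a ∷_) (compositions m))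

arndtSum-compositions-suc : ∀ w m →
  arndtSum w (compositions (suc m)) ≡ antidiagonalSum m (λ i j → headedSum w i (suc j))
arndtSum-compositions-suc w m = begin
  arndtSum w (compositions (suc m))
    ≡⟨ cong (arndtSum w) (compositions-suc m) ⟩
  arndtSum w (concatMap (λ k → map (suc k ∷_) (compositions (m ∸ k))) (upTo (suc m)))
    ≡⟨ arndtSum-concatMap w (λ k → map (suc k ∷_) (compositions (m ∸ k))) (upTo (suc m)) ⟩
  sum (map (λ k → headedSum w (m ∸ k) (suc k)) (upTo (suc m)))
    ≡⟨ sum-upTo-antidiagonal m (λ i j → headedSum w i (suc j)) ⟩
  antidiagonalSum m (λ i j → headedSum w i (suc j)) ∎
  where open ≡-Reasoning

headedSum-suc : ∀ w m a → headedSum w (suc m) a ≡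
  antidiagonalSum m (λ i j → if suc j <ᵇ a then arndtSum (λ c → w (a ∷ suc j ∷ c)) (compositions i) else 0)
headedSum-suc w m a = begin
  arndtSum w (map (a ∷_) (compositions (suc m)))
    ≡⟨ cong (arndtSum w ∘ map (a ∷_)) (compositions-suc m) ⟩
  arndtSum w (map (a ∷_) (concatMap (λ k → map (suc k ∷_) (compositions (m ∸ k))) (upTo (suc m))))
    ≡⟨ cong (arndtSum w) (map-concatMap (a ∷_) (λ k → map (suc k ∷_) (compositions (m ∸ k))) (upTo (suc m))) ⟩
  arndtSum w (concatMap (λ k → map (a ∷_) (map (suc k ∷_) (compositions (m ∸ k)))) (upTo (suc m)))
    ≡⟨ arndtSum-concatMap w (λ k → map (a ∷_) (map (suc k ∷_) (compositions (m ∸ k)))) (upTo (suc m)) ⟩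
  sum (map (λ k → arndtSum w (map (a ∷_) (map (suc k ∷_) (compositions (m ∸ k))))) (upTo (suc m)))
    ≡⟨ cong sum (map-cong (λ k → arndtSum-pair w a (suc k) (compositions (m ∸ k))) (upTo (suc m))) ⟩
  sum (map (λ k → pairTerm (m ∸ k) k) (upTo (suc m)))
    ≡⟨ sum-upTo-antidiagonal m pairTerm ⟩
  antidiagonalSum m pairTerm ∎
  where
  open ≡-Reasoning
  pairTerm : ℕ → ℕ → ℕ
  pairTerm i j = if suc j <ᵇ a then arndtSum (λ c → w (a ∷ suc j ∷ c)) (compositions i) else 0

arndtSum-compositions-suc-cong : ∀ {w w′} m → (∀ a c → w (a ∷ c) ≡ w′ (a ∷ c)) →
  arndtSum w (compositions (suc m)) ≡ arndtSum w′ (compositions (suc m))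
arndtSum-compositions-suc-cong {w} {w′} m eq = begin
  arndtSum w (compositions (suc m))
    ≡⟨ arndtSum-compositions-suc w m ⟩
  antidiagonalSum m (λ i j → headedSum w i (suc j))
    ≡⟨ antidiagonalSum-cong m (λ i j → arndtSum-cons-cong (suc j) (eq (suc j)) (compositions i)) ⟩
  antidiagonalSum m (λ i j → headedSum w′ i (suc j))
    ≡⟨ arndtSum-compositions-suc w′ m ⟨
  arndtSum w′ (compositions (suc m)) ∎
  where open ≡-Reasoning

arndtNumber : ℕ → ℕ
arndtNumber n = arndtSum (λ _ → 1) (compositions n)

headedNumber : ℕ → ℕ → ℕ
headedNumber = headedSum (λ _ → 1)

-- headedNumberGap i j counts the Arndt compositions of i + j + 2 opening with (j + 2, j + 1).
headedNumberGap : ℕ → ℕ → ℕ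
headedNumberGap zero    j = 0
headedNumberGap (suc m) j = antidiagonalEntry m j (λ i _ → arndtNumber i)

headedNumber-suc : ∀ m c → headedNumber (suc m) (suc c) ≡ antidiagonalSumBelow m c (λ i _ → arndtNumber i)
headedNumber-suc m c = headedSum-suc _ m (suc c)

headedNumber-step : ∀ i j → headedNumber i (suc (suc j)) ≡ headedNumber i (suc j) + headedNumberGap i j
headedNumber-step zero    j = refl
headedNumber-step (suc m) j = trans (headedNumber-suc m (suc j))
  (trans (antidiagonalSumBelow-suc m j (λ i _ → arndtNumber i))
         (cong (_+ headedNumberGap (suc m) j) (sym (headedNumber-suc m j))))

arndtNumberGap : ℕ → ℕ
arndtNumberGap n = antidiagonalSum n headedNumberGap

arndtNumber-rec : ∀ n → arndtNumber (suc (suc n)) ≡ arndtNumber (suc n) + arndtNumberGap n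
arndtNumber-rec n = begin
  arndtNumber (suc (suc n))
    ≡⟨ arndtSum-compositions-suc _ (suc n) ⟩
  headedNumber (suc n) 1 + antidiagonalSum n (λ i j → headedNumber i (suc (suc j)))
    ≡⟨ cong₂ _+_ (trans (headedNumber-suc n 0) (antidiagonalSum-zero n))
                 (antidiagonalSum-cong n headedNumber-step) ⟩
  antidiagonalSum n (λ i j → headedNumber i (suc j) + headedNumberGap i j)
    ≡⟨ antidiagonalSum-+ n (λ i j → headedNumber i (suc j)) headedNumberGap ⟩
  antidiagonalSum n (λ i j → headedNumber i (suc j)) + arndtNumberGap n
    ≡⟨ cong (_+ arndtNumberGap n) (arndtSum-compositions-suc _ n) ⟨
  arndtNumber (suc n) + arndtNumberGap n ∎
  where open ≡-Reasoning

arndtNumberGap-rec : ∀ n → arndtNumberGap (suc (suc n)) ≡ arndtNumber (suc n) + arndtNumberGap n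
arndtNumberGap-rec n = cong (_+_ (arndtNumber (suc n))) (begin
  antidiagonalSum (suc n) (λ i j → headedNumberGap i (suc j))
    ≡⟨ antidiagonalSum-peel n (λ i j → headedNumberGap i (suc j)) ⟩
  antidiagonalSum n (λ i j → headedNumberGap (suc i) (suc j)) + 0
    ≡⟨ +-identityʳ _ ⟩
  antidiagonalSum n (λ i j → headedNumberGap (suc i) (suc j))
    ≡⟨ antidiagonalSum-cong n shift ⟩
  arndtNumberGap n ∎)
  where
  open ≡-Reasoning
  shift : ∀ i j → headedNumberGap (suc i) (suc j) ≡ headedNumberGap i j
  shift zero    j = refl
  shift (suc i) j = refl

fib : ℕ → ℕ
fib zero          = 0
fib (suc zero)    = 1
fib (suc (suc n)) = fib (suc n) + fib n

fib-growth : ∀ n → suc n ≤ fib (suc (suc n))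
fib-growth zero          = s≤s z≤n
fib-growth (suc zero)    = s≤s (s≤s z≤n)
fib-growth (suc (suc n)) = ≤-trans (s≤s (s≤s (m≤n+m (suc n) n)))
                                    (+-mono-≤ (fib-growth (suc n)) (fib-growth n))

fib-suc-positive : ∀ n → 0 < fib (suc n)
fib-suc-positive zero    = s≤s z≤n
fib-suc-positive (suc n) = ≤-trans (s≤s z≤n) (fib-growth n)

arndtNumber-fib : ∀ n → arndtNumber (suc n) ≡ fib (suc n) × arndtNumberGap n ≡ fib n
arndtNumber-fib zero          = refl , refl
arndtNumber-fib (suc zero)    = refl , refl
arndtNumber-fib (suc (suc n)) with arndtNumber-fib n | arndtNumber-fib (suc n)
... | a₀ , g₀ | a₁ , g₁ = trans (arndtNumber-rec (suc n)) (cong₂ _+_ a₁ g₁)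
                        , trans (arndtNumberGap-rec n) (cong₂ _+_ a₀ g₀)

arndtCount≡arndtNumber : ∀ n → arndtCount n ≡ arndtNumber n
arndtCount≡arndtNumber n = length≡sum-ones (filterᵇ isArndt (compositions n))
  where
  length≡sum-ones : ∀ (L : List (List ℕ)) → length L ≡ sum (map (λ _ → 1) L)
  length≡sum-ones []      = refl
  length≡sum-ones (_ ∷ L) = cong suc (length≡sum-ones L)

arndtCount-fib : ∀ n → arndtCount (suc n) ≡ fib (suc n)
arndtCount-fib n = trans (arndtCount≡arndtNumber (suc n)) (proj₁ (arndtNumber-fib n))

headedLast : ℕ → ℕ → ℕ
headedLast = headedSum lastPart

pairLast : ℕ → ℕ → ℕ
pairLast zero    b = b
pairLast (suc i) b = lastPartTotal (suc i)

pairLast-suc : ∀ i b → pairLast i (suc b) ≡ pairLast i b + zeroBit i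
pairLast-suc zero    b = sym (+-comm b 1)
pairLast-suc (suc i) b = sym (+-identityʳ _)

arndtSum-lastPart-cons : ∀ i b → arndtSum (λ c → lastPart (b ∷ c)) (compositions i) ≡ pairLast i b
arndtSum-lastPart-cons zero    b = +-identityʳ b
arndtSum-lastPart-cons (suc i) b = arndtSum-compositions-suc-cong i (λ _ _ → refl)

headedLast-suc : ∀ m c → headedLast (suc m) (suc c) ≡ antidiagonalSumBelow m c (λ i j → pairLast i (suc j))
headedLast-suc m c = trans (headedSum-suc lastPart m (suc c)) (antidiagonalSum-cong m
  (λ i j → cong (λ x → if j <ᵇ c then x else 0) (arndtSum-lastPart-cons i (suc j))))

headedLastGap : ℕ → ℕ → ℕ
headedLastGap zero    j = 1
headedLastGap (suc m) j = antidiagonalEntry m j (λ i j → pairLast i (suc j))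

headedLast-step : ∀ i j → headedLast i (suc (suc j)) ≡ headedLast i (suc j) + headedLastGap i j
headedLast-step zero    j = sym (+-comm (suc j + 0) 1)
headedLast-step (suc m) j = trans (headedLast-suc m (suc j))
  (trans (antidiagonalSumBelow-suc m j (λ i j → pairLast i (suc j)))
         (cong (_+ headedLastGap (suc m) j) (sym (headedLast-suc m j))))

headedLastGap-shift : ∀ m j → headedLastGap (suc (suc m)) (suc j) ≡ headedLastGap (suc m) j + diagonalBit m j
headedLastGap-shift m j = begin
  antidiagonalEntry m j (λ i j → pairLast i (suc (suc j)))
    ≡⟨ antidiagonalEntry-cong m j (λ i j → pairLast-suc i (suc j)) ⟩
  antidiagonalEntry m j (λ i j → pairLast i (suc j) + zeroBit i)
    ≡⟨ antidiagonalEntry-+ m j (λ i j → pairLast i (suc j)) (λ i _ → zeroBit i) ⟩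
  headedLastGap (suc m) j + antidiagonalEntry m j (λ i _ → zeroBit i)
    ≡⟨ cong (_+_ (headedLastGap (suc m) j)) (antidiagonalEntry-zeroBit m j) ⟩
  headedLastGap (suc m) j + diagonalBit m j ∎
  where open ≡-Reasoning

lastPartGap : ℕ → ℕ
lastPartGap n = antidiagonalSum n headedLastGap

lastPartTotal-rec : ∀ n → lastPartTotal (suc (suc n)) ≡ lastPartTotal (suc n) + lastPartGap n
lastPartTotal-rec n = begin
  lastPartTotal (suc (suc n))
    ≡⟨ arndtSum-compositions-suc lastPart (suc n) ⟩
  headedLast (suc n) 1 + antidiagonalSum n (λ i j → headedLast i (suc (suc j)))
    ≡⟨ cong₂ _+_ (trans (headedLast-suc n 0) (antidiagonalSum-zero n))
                 (antidiagonalSum-cong n headedLast-step) ⟩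
  antidiagonalSum n (λ i j → headedLast i (suc j) + headedLastGap i j)
    ≡⟨ antidiagonalSum-+ n (λ i j → headedLast i (suc j)) headedLastGap ⟩
  antidiagonalSum n (λ i j → headedLast i (suc j)) + lastPartGap n
    ≡⟨ cong (_+ lastPartGap n) (arndtSum-compositions-suc lastPart n) ⟨
  lastPartTotal (suc n) + lastPartGap n ∎
  where open ≡-Reasoning

-- oddBit n: for odd n the composition (a + 1, a) of n + 4 has a last part one larger than
-- its lowered image (a, a − 1).
lastPartGap-rec : ∀ n → lastPartGap (suc (suc n)) ≡ lastPartTotal (suc n) + lastPartGap n + oddBit n
lastPartGap-rec zero    = refl
lastPartGap-rec (suc n) = begin
  lastPartGap (suc (suc (suc n)))
    ≡⟨ cong (_+_ total) (antidiagonalSum-peel (suc n) (λ i j → headedLastGap i (suc j))) ⟩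
  total + (antidiagonalSum (suc n) (λ i j → headedLastGap (suc i) (suc j)) + 1)
    ≡⟨ cong (λ x → total + (x + 1)) inner ⟩
  total + ((rest + evenBit n) + 1)
    ≡⟨ rearrange total rest (evenBit n) ⟩
  total + (rest + 1) + evenBit n
    ≡⟨ cong (λ x → total + x + evenBit n) (antidiagonalSum-peel n headedLastGap) ⟨
  total + lastPartGap (suc n) + oddBit (suc n) ∎
  where
  open ≡-Reasoning
  total = lastPartTotal (suc (suc n))
  rest  = antidiagonalSum n (λ i j → headedLastGap (suc i) j)
  rearrange : ∀ t s e → t + ((s + e) + 1) ≡ t + (s + 1) + e
  rearrange = solve-∀
  inner : antidiagonalSum (suc n) (λ i j → headedLastGap (suc i) (suc j)) ≡ rest + evenBit n
  inner = begin
    antidiagonalSum (suc n) (λ i j → headedLastGap (suc i) (suc j))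
      ≡⟨ antidiagonalSum-peel n (λ i j → headedLastGap (suc i) (suc j)) ⟩
    antidiagonalSum n (λ i j → headedLastGap (suc (suc i)) (suc j)) + 0
      ≡⟨ +-identityʳ _ ⟩
    antidiagonalSum n (λ i j → headedLastGap (suc (suc i)) (suc j))
      ≡⟨ antidiagonalSum-cong n headedLastGap-shift ⟩
    antidiagonalSum n (λ i j → headedLastGap (suc i) j + diagonalBit i j)
      ≡⟨ antidiagonalSum-+ n (λ i j → headedLastGap (suc i) j) diagonalBit ⟩
    rest + antidiagonalSum n diagonalBit
      ≡⟨ cong (_+_ rest) (antidiagonalSum-diagonalBit n) ⟩
    rest + evenBit n ∎

lucas : ℕ → ℕ
lucas zero          = 2
lucas (suc zero)    = 1
lucas (suc (suc n)) = lucas (suc n) + lucas n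

lastPartTotal-lucas : ∀ n →
  lastPartTotal (suc n) + evenBit (suc n) ≡ lucas (suc n) × lastPartGap n + evenBit n ≡ lucas n + oddBit n
lastPartTotal-lucas zero          = refl , refl
lastPartTotal-lucas (suc zero)    = refl , refl
lastPartTotal-lucas (suc (suc n)) with lastPartTotal-lucas n | lastPartTotal-lucas (suc n)
... | l₀ , g₀ | l₁ , g₁ = total-step , gap-step
  where
  open ≡-Reasoning
  total-step : lastPartTotal (suc (suc (suc n))) + evenBit (suc n) ≡ lucas (suc (suc (suc n)))
  total-step = begin
    lastPartTotal (suc (suc (suc n))) + evenBit (suc n)
      ≡⟨ cong (_+ evenBit (suc n)) (lastPartTotal-rec (suc n)) ⟩
    lastPartTotal (suc (suc n)) + lastPartGap (suc n) + evenBit (suc n)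
      ≡⟨ +-assoc (lastPartTotal (suc (suc n))) _ _ ⟩
    lastPartTotal (suc (suc n)) + (lastPartGap (suc n) + evenBit (suc n))
      ≡⟨ cong (_+_ (lastPartTotal (suc (suc n)))) g₁ ⟩
    lastPartTotal (suc (suc n)) + (lucas (suc n) + evenBit n)
      ≡⟨ swap (lastPartTotal (suc (suc n))) (lucas (suc n)) (evenBit n) ⟩
    lastPartTotal (suc (suc n)) + evenBit n + lucas (suc n)
      ≡⟨ cong (_+ lucas (suc n)) l₁ ⟩
    lucas (suc (suc (suc n))) ∎
    where
    swap : ∀ b l e → b + (l + e) ≡ b + e + l
    swap = solve-∀
  gap-step : lastPartGap (suc (suc n)) + evenBit n ≡ lucas (suc (suc n)) + oddBit n
  gap-step = begin
    lastPartGap (suc (suc n)) + evenBit n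
      ≡⟨ cong (_+ evenBit n) (lastPartGap-rec n) ⟩
    lastPartTotal (suc n) + lastPartGap n + oddBit n + evenBit n
      ≡⟨ regroup (lastPartTotal (suc n)) (lastPartGap n) (oddBit n) (evenBit n) ⟩
    (lastPartGap n + evenBit n) + (lastPartTotal (suc n) + oddBit n)
      ≡⟨ cong₂ _+_ g₀ l₀ ⟩
    (lucas n + oddBit n) + lucas (suc n)
      ≡⟨ regroup′ (lucas n) (oddBit n) (lucas (suc n)) ⟩
    lucas (suc (suc n)) + oddBit n ∎
    where
    regroup : ∀ b g o e → b + g + o + e ≡ (g + e) + (b + o)
    regroup = solve-∀
    regroup′ : ∀ a o b → (a + o) + b ≡ (b + a) + o
    regroup′ = solve-∀

fibForm : ℤ → ℤ → ℤ
fibForm a b = a ℤ.* a ℤ.- a ℤ.* b ℤ.- b ℤ.* b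

fibForm-step : ∀ a b → fibForm (a ℤ.+ b) a ≡ ℤ.- fibForm a b
fibForm-step = expanded
  where
  expanded : ∀ a b → (a ℤ.+ b) ℤ.* (a ℤ.+ b) ℤ.- (a ℤ.+ b) ℤ.* a ℤ.- a ℤ.* a
                   ≡ ℤ.- (a ℤ.* a ℤ.- a ℤ.* b ℤ.- b ℤ.* b)
  expanded = ℤ-Solver.solve-∀

cassini : ∀ n → fibForm (+ fib (suc n)) (+ fib n) ≡ -1ℤ ^ n
cassini zero    = refl
cassini (suc n) = begin
  fibForm (+ fib (suc (suc n))) (+ fib (suc n))
    ≡⟨ cong (λ x → fibForm x (+ fib (suc n))) (ℤ.pos-+ (fib (suc n)) (fib n)) ⟩
  fibForm (+ fib (suc n) ℤ.+ + fib n) (+ fib (suc n))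
    ≡⟨ fibForm-step (+ fib (suc n)) (+ fib n) ⟩
  ℤ.- fibForm (+ fib (suc n)) (+ fib n)
    ≡⟨ cong ℤ.-_ (cassini n) ⟩
  ℤ.- (-1ℤ ^ n)
    ≡⟨ ℤ.-1*i≡-i (-1ℤ ^ n) ⟨
  -1ℤ ^ suc n ∎
  where open ≡-Reasoning

lucas+fib : ∀ n → lucas n + fib n ≡ 2 * fib (suc n)
lucas+fib zero          = refl
lucas+fib (suc zero)    = refl
lucas+fib (suc (suc n)) = begin
  (lucas (suc n) + lucas n) + (fib (suc n) + fib n)
    ≡⟨ interchange (lucas (suc n)) (lucas n) (fib (suc n)) (fib n) ⟩
  (lucas (suc n) + fib (suc n)) + (lucas n + fib n)
    ≡⟨ cong₂ _+_ (lucas+fib (suc n)) (lucas+fib n) ⟩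
  2 * fib (suc (suc n)) + 2 * fib (suc n)
    ≡⟨ *-distribˡ-+ 2 (fib (suc (suc n))) (fib (suc n)) ⟨
  2 * fib (suc (suc (suc n))) ∎
  where open ≡-Reasoning

lucas-sq : ∀ n → + (lucas n * lucas n) ≡ + 5 ℤ.* + (fib n * fib n) ℤ.+ + 4 ℤ.* -1ℤ ^ n
lucas-sq n = begin
  + (lucas n * lucas n)
    ≡⟨ ℤ.pos-* (lucas n) (lucas n) ⟩
  L ℤ.* L
    ≡⟨ cong (λ x → x ℤ.* x) L≡2F′-F ⟩
  (+ 2 ℤ.* F′ ℤ.- F) ℤ.* (+ 2 ℤ.* F′ ℤ.- F)
    ≡⟨ square-expansion F′ F ⟩
  + 5 ℤ.* (F ℤ.* F) ℤ.+ + 4 ℤ.* fibForm F′ F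
    ≡⟨ cong₂ (λ x y → + 5 ℤ.* x ℤ.+ + 4 ℤ.* y) (sym (ℤ.pos-* (fib n) (fib n))) (cassini n) ⟩
  + 5 ℤ.* + (fib n * fib n) ℤ.+ + 4 ℤ.* -1ℤ ^ n ∎
  where
  open ≡-Reasoning
  L  = + lucas n
  F  = + fib n
  F′ = + fib (suc n)
  square-expansion : ∀ x y → (+ 2 ℤ.* x ℤ.- y) ℤ.* (+ 2 ℤ.* x ℤ.- y) ≡
    + 5 ℤ.* (y ℤ.* y) ℤ.+ + 4 ℤ.* (x ℤ.* x ℤ.- x ℤ.* y ℤ.- y ℤ.* y)
  square-expansion = ℤ-Solver.solve-∀
  cancel : ∀ x y → x ≡ (x ℤ.+ y) ℤ.- y
  cancel = ℤ-Solver.solve-∀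
  L≡2F′-F : L ≡ + 2 ℤ.* F′ ℤ.- F
  L≡2F′-F = begin
    L                  ≡⟨ cancel L F ⟩
    (L ℤ.+ F) ℤ.- F    ≡⟨ cong (ℤ._- F) (ℤ.pos-+ (lucas n) (fib n)) ⟨
    + (lucas n + fib n) ℤ.- F ≡⟨ cong (λ x → + x ℤ.- F) (lucas+fib n) ⟩
    + (2 * fib (suc n)) ℤ.- F ≡⟨ cong (ℤ._- F) (ℤ.pos-* 2 (fib (suc n))) ⟩
    + 2 ℤ.* F′ ℤ.- F ∎

evenBit-sign : ∀ n → (evenBit n ≡ 1 × -1ℤ ^ n ≡ 1ℤ) ⊎ (evenBit n ≡ 0 × -1ℤ ^ n ≡ -1ℤ)
evenBit-sign zero          = inj₁ (refl , refl)
evenBit-sign (suc zero)    = inj₂ (refl , refl)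
evenBit-sign (suc (suc n)) with evenBit-sign n
... | inj₁ (e , s) = inj₁ (e , cong (λ x → -1ℤ ℤ.* (-1ℤ ℤ.* x)) s)
... | inj₂ (e , s) = inj₂ (e , cong (λ x → -1ℤ ℤ.* (-1ℤ ℤ.* x)) s)

lucas-sq-parity : ∀ n →
    (evenBit n ≡ 1 × lucas n * lucas n ≡ 5 * (fib n * fib n) + 4)
  ⊎ (evenBit n ≡ 0 × lucas n * lucas n + 4 ≡ 5 * (fib n * fib n))
lucas-sq-parity n with evenBit-sign n | lucas-sq n
... | inj₁ (e , s) | eq rewrite s = inj₁ (e , ℤ.+-injective (trans eq (sym (begin
  + (5 * (fib n * fib n) + 4)         ≡⟨ ℤ.pos-+ (5 * (fib n * fib n)) 4 ⟩
  + (5 * (fib n * fib n)) ℤ.+ + 4     ≡⟨ cong (ℤ._+ + 4) (ℤ.pos-* 5 (fib n * fib n)) ⟩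
  + 5 ℤ.* + (fib n * fib n) ℤ.+ + 4   ∎))))
  where open ≡-Reasoning
... | inj₂ (e , s) | eq rewrite s = inj₂ (e , ℤ.+-injective (begin
  + (lucas n * lucas n + 4)                           ≡⟨ ℤ.pos-+ (lucas n * lucas n) 4 ⟩
  + (lucas n * lucas n) ℤ.+ + 4                       ≡⟨ cong (ℤ._+ + 4) eq ⟩
  + 5 ℤ.* + (fib n * fib n) ℤ.+ -[1+ 3 ] ℤ.+ + 4      ≡⟨ ℤ.+-assoc (+ 5 ℤ.* + (fib n * fib n)) -[1+ 3 ] (+ 4) ⟩
  + 5 ℤ.* + (fib n * fib n) ℤ.+ + 0                   ≡⟨ ℤ.+-identityʳ _ ⟩
  + 5 ℤ.* + (fib n * fib n)                           ≡⟨ ℤ.pos-* 5 (fib n * fib n) ⟨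
  + (5 * (fib n * fib n))                             ∎))
  where open ≡-Reasoning

square-bounds-odd : ∀ B a → B * B + 4 ≡ 5 * (a * a) →
  B * B < 5 * (a * a) × 5 * (a * a) ≤ (B + 2) * (B + 2)
square-bounds-odd B a h =
    subst (B * B <_) h (m<m+n (B * B) (s≤s z≤n))
  , subst (_≤ (B + 2) * (B + 2)) h (subst (B * B + 4 ≤_) (sym (expand B)) (m≤m+n (B * B + 4) (4 * B)))
  where
  expand : ∀ B → (B + 2) * (B + 2) ≡ B * B + 4 + 4 * B
  expand = solve-∀

square-bounds-even : ∀ B a → 0 < a → (B + 1) * (B + 1) ≡ 5 * (a * a) + 4 →
  B * B < 5 * (a * a) × 5 * (a * a) ≤ (B + 2) * (B + 2)
square-bounds-even B (suc a) _ h = lower B h , upper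
  where
  Q = 5 * (suc a * suc a)
  upper : Q ≤ (B + 2) * (B + 2)
  upper = ≤-trans (m≤m+n Q 4)
    (subst (_≤ (B + 2) * (B + 2)) h (*-mono-≤ B+1≤B+2 B+1≤B+2))
    where B+1≤B+2 = +-monoʳ-≤ B (n≤1+n 1)
  lower : ∀ B → (B + 1) * (B + 1) ≡ Q + 4 → B * B < Q
  lower zero          h = contradiction (subst (4 ≤_) (sym h) (m≤n+m 4 Q)) λ { (s≤s ()) }
  lower (suc zero)    h with +-cancelʳ-≡ 4 0 Q h
  ... | ()
  lower (suc (suc b)) h =
    subst (suc (suc b) * suc (suc b) <_) (+-cancelʳ-≡ 4 _ Q (trans (sym (expand b)) h))
      (s≤s (m≤m+n _ (2 * b)))
    where
    expand : ∀ b → (suc (suc b) + 1) * (suc (suc b) + 1) ≡ suc (suc (suc b) * suc (suc b) + 2 * b) + 4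
    expand = solve-∀

lastPartTotal-square-bounds : ∀ n → let B = lastPartTotal (suc n); a = arndtCount (suc n) in
  B * B < 5 * (a * a) × 5 * (a * a) ≤ (B + 2) * (B + 2)
lastPartTotal-square-bounds n rewrite arndtCount-fib n
  with lucas-sq-parity (suc n) | proj₁ (lastPartTotal-lucas n)
... | inj₁ (even , sq) | B+e≡L = square-bounds-even B F (fib-suc-positive n)
  (subst (λ x → x * x ≡ 5 * (F * F) + 4) (sym (subst (λ e → B + e ≡ L) even B+e≡L)) sq)
  where B = lastPartTotal (suc n); F = fib (suc n); L = lucas (suc n)
... | inj₂ (odd , sq) | B+e≡L = square-bounds-odd B F
  (subst (λ x → x * x + 4 ≡ 5 * (F * F)) (sym (trans (sym (+-identityʳ B)) (subst (λ e → B + e ≡ L) odd B+e≡L))) sq)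
  where B = lastPartTotal (suc n); F = fib (suc n); L = lucas (suc n)

square<five : ∀ x m → x * x < 5 * (suc m * suc m) → mkℚᵘ (+ x) m ℚ.* mkℚᵘ (+ x) m ℚ.< five
square<five x m h = *<* (subst₂ ℤ._<_
  (trans (ℤ.pos-* x x) (sym (ℤ.*-identityʳ _))) (ℤ.pos-* 5 (suc m * suc m)) (ℤ.+<+ h))

five<square : ∀ {n} x m → n ≡ + x → 5 * (suc m * suc m) < x * x → five ℚ.< mkℚᵘ n m ℚ.* mkℚᵘ n m
five<square x m refl h = *<* (subst₂ ℤ._<_
  (ℤ.pos-* 5 (suc m * suc m)) (trans (ℤ.pos-* x x) (sym (ℤ.*-identityʳ _))) (ℤ.+<+ h))

-- B/a ≤ √5 ≤ (B + 2)/a, and 2/a < ε puts (B + 2)/a below q + ε.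
sqrt5-bracket : ∀ B a p d → B * B < 5 * (a * a) → 5 * (a * a) ≤ (B + 2) * (B + 2) → 2 * suc d < a →
  let q = mkℚᵘ (+ B) (a ∸ 1); ε = mkℚᵘ +[1+ p ] d in
  BelowSqrt5 (q ℚ.- ε) × AboveSqrt5 (q ℚ.+ ε)
sqrt5-bracket B (suc a) p d lower upper gap =
  below , ℚ.<-≤-trans ε>0 (ℚ.p≤q+p ε q) , five<square N (d + a * D) numerator N²>5A²D²
  where
  q  = mkℚᵘ (+ B) a
  ε  = mkℚᵘ +[1+ p ] d
  A  = suc a
  D  = suc d
  N  = B * D + suc p * A
  ε>0 : 0ℚᵘ ℚ.< ε
  ε>0 = *<* (ℤ.+<+ (s≤s z≤n))
  q-ε≤q : q ℚ.- ε ℚ.≤ q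
  q-ε≤q = ℚ.≤-respʳ-≃ (ℚ.+-identityʳ q) (ℚ.+-monoʳ-≤ q (ℚ.neg-mono-≤ (ℚ.<⇒≤ ε>0)))
  below : BelowSqrt5 (q ℚ.- ε)
  below with q ℚ.- ε ℚ.<? 0ℚᵘ
  ... | yes q-ε<0 = inj₁ q-ε<0
  ... | no  q-ε≮0 = inj₂ (ℚ.≤-<-trans (ℚ.*-mono-≤-nonNeg {{nn}} {{nn}} q-ε≤q q-ε≤q) (square<five B a lower))
    where nn = nonNegative (ℚ.≮⇒≥ q-ε≮0)
  numerator : + B ℤ.* + D ℤ.+ +[1+ p ] ℤ.* + A ≡ + N
  numerator = sym (trans (ℤ.pos-+ (B * D) (suc p * A)) (cong₂ ℤ._+_ (ℤ.pos-* B D) (ℤ.pos-* (suc p) A)))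
  N²>5A²D² : 5 * ((A * D) * (A * D)) < N * N
  N²>5A²D² = begin-strict
    5 * ((A * D) * (A * D))           ≡⟨ regroup A D ⟩
    5 * (A * A) * (D * D)             ≤⟨ *-monoˡ-≤ (D * D) upper ⟩
    (B + 2) * (B + 2) * (D * D)       ≡⟨ expand B D ⟩
    (B * D + 2 * D) * (B * D + 2 * D) <⟨ *-mono-< shifted shifted ⟩
    N * N                             ∎
    where
    open ≤-Reasoning
    regroup : ∀ A D → 5 * ((A * D) * (A * D)) ≡ 5 * (A * A) * (D * D)
    regroup = solve-∀
    expand : ∀ B D → (B + 2) * (B + 2) * (D * D) ≡ (B * D + 2 * D) * (B * D + 2 * D)
    expand = solve-∀
    shifted : B * D + 2 * D < N
    shifted = +-monoʳ-< (B * D) (<-≤-trans gap (m≤n*m A (suc p)))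

corollary3p5 : ConvergesToSqrt5 expectedLast
corollary3p5 (mkℚᵘ (+ zero) d)   (*<* (ℤ.+<+ ()))
corollary3p5 (mkℚᵘ -[1+ p ] d)   (*<* ())
corollary3p5 (mkℚᵘ +[1+ p ] d) _ = 2 + 2 * suc d , λ where
  (suc (suc m)) (s≤s (s≤s 2D≤m)) →
    let lower , upper = lastPartTotal-square-bounds (suc m) in
    sqrt5-bracket (lastPartTotal (suc (suc m))) (arndtCount (suc (suc m))) p d lower upper
      (subst (2 * suc d <_) (sym (arndtCount-fib (suc m))) (≤-trans (s≤s 2D≤m) (fib-growth m)))
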